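{- Let $a,b,c,d$ be nonnegative integers with $|(a+b)-(c+d)|=1$, and consider the Simple Chopsticks position $P=[1^a,2^b]\,[1^c,2^d]_2$. 1. If $a+b>c+d$, then $P$ has outcome $\mathcal{P}$ if $c=d=0$; $\mathcal{N}$ if $d=0$, $b>0$ and $a$ is odd; and $\mathcal{L}$ otherwise. 2. If $a+b<c+d$, then $P$ has outcome $\mathcal{P}$ if $a=b=0$; $\mathcal{N}$ if $b=0$, $d>0$ and $c$ is odd; and $\mathcal{R}$ otherwise.
   Context: Simple Chopsticks. Fix a positive integer $n$, the finger count. A position $[x_1,\ldots,x_\ell]\,[y_1,\ldots,y_r]_n$ consists of a finite non-decreasing sequence of integers in $\{1,\ldots,n\}$ for Left (her hands) and one for Right; either list may be empty. Left's moves: for any $i,j$, replace $y_j$ by $y_j+x_i$, removing the entry from Right's list if $y_j+x_i>n$. Right's moves: for any $i,j$, replace $x_i$ by $x_i+y_j$, removing it if $x_i+y_j>n$. No moves exist when either list is empty. Normal play: a player unable to move loses. Notation: $k^a$ denotes $k$ repeated $a$ times, so $[1^a,2^b]\,[1^c,2^d]_2$ means finger count $2$, Left has $a$ hands with one finger and $b$ with two, Right has $c$ with one and $d$ with two. Outcomes: $\mathcal{N}$ = first player wins, $\mathcal{P}$ = second player wins, $\mathcal{L}$ = Left wins whoever starts, $\mathcal{R}$ = Right wins whoever starts. -}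

module Defs where

open import Data.Nat using (ℕ; _+_; _<_; _<?_)
open import Data.List using (List; length; lookup; updateAt; removeAt; replicate; _++_)
open import Data.Fin using (Fin)
open import Data.Product using (_×_; _,_)
open import Relation.Nullary using (yes; no)

-- A position: (Left's hands , Right's hands); each hand is a finger count.
-- Lists are taken up to reordering (outcome is permutation invariant).
Pos : Set
Pos = List ℕ × List ℕ

hit : ℕ → (ys : List ℕ) → Fin (length ys) → ℕ → List ℕ
hit n ys j x with n <? lookup ys j + x
... | yes _ = removeAt ys j
... | no  _ = updateAt ys j (λ y → y + x)

data LeftMove (n : ℕ) : Pos → Pos → Set where
  lmove : (xs ys : List ℕ) (i : Fin (length xs)) (j : Fin (length ys)) →
          LeftMove n (xs , ys) (xs , hit n ys j (lookup xs i))

data RightMove (n : ℕ) : Pos → Pos → Set where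
  rmove : (xs ys : List ℕ) (i : Fin (length xs)) (j : Fin (length ys)) →
          RightMove n (xs , ys) (hit n xs i (lookup ys j) , ys)

-- Winning under normal play (the game is short, so inductive = winning strategy).
mutual
  data LeftWinsFirst (n : ℕ) (p : Pos) : Set where
    lwf : (p' : Pos) → LeftMove n p p' → LeftWinsSecond n p' → LeftWinsFirst n p

  data LeftWinsSecond (n : ℕ) (p : Pos) : Set where
    lws : ((p' : Pos) → RightMove n p p' → LeftWinsFirst n p') → LeftWinsSecond n p

mutual
  data RightWinsFirst (n : ℕ) (p : Pos) : Set where
    rwf : (p' : Pos) → RightMove n p p' → RightWinsSecond n p' → RightWinsFirst n p

  data RightWinsSecond (n : ℕ) (p : Pos) : Set where
    rws : ((p' : Pos) → LeftMove n p p' → RightWinsFirst n p') → RightWinsSecond n p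

data Outcome : Set where
  𝓝 𝓟 𝓛 𝓡 : Outcome

HasOutcome : ℕ → Pos → Outcome → Set
HasOutcome n p 𝓝 = LeftWinsFirst n p × RightWinsFirst n p
HasOutcome n p 𝓟 = LeftWinsSecond n p × RightWinsSecond n p
HasOutcome n p 𝓛 = LeftWinsFirst n p × LeftWinsSecond n p
HasOutcome n p 𝓡 = RightWinsFirst n p × RightWinsSecond n p

_^^_ : ℕ → ℕ → List ℕ
k ^^ a = replicate a k

pos12 : ℕ → ℕ → ℕ → ℕ → Pos
pos12 a b c d = (1 ^^ a ++ 2 ^^ b , 1 ^^ c ++ 2 ^^ d)

-- Only the numbers of one-finger and two-finger hands matter, so play can be followed on tallies.
-- Left's wins are certified by two explicit families of tallies, WinsFirst (Left to move) and
-- WinsSecond (Right to move): from a WinsFirst tally Left has a hit into WinsSecond, and every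
-- hit of Right from a WinsSecond tally lands in WinsFirst. A hit lowers 2·ones + twos of the side
-- hit, so play is finite and both families are winning for Left. They must also contain tallies
-- whose hand counts differ by 0 or by at least 2, since play from the theorem's positions passes
-- through those. Right's outcomes follow by exchanging the two sides.
module Submission where

open import Defs
open import Data.Nat using (ℕ; zero; suc; _+_; _<_; _≤_; _%_; z≤n; s≤s; _<?_)
open import Data.Nat.Properties
open import Data.List using (List; []; _∷_; length; lookup; _++_)
open import Data.Fin using (Fin; zero; suc)
open import Data.Product using (_×_; _,_; ∃; ∃₂)
open import Data.Sum using (inj₁; inj₂)
open import Relation.Binary.PropositionalEquality using (_≡_; refl; sym; trans; cong; subst)
open import Relation.Nullary using (¬_; yes; no; contradiction)

odd-suc⇒¬odd : ∀ n → suc n % 2 ≡ 1 → ¬ (n % 2 ≡ 1)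
odd-suc⇒¬odd zero          _ ()
odd-suc⇒¬odd (suc zero)    ()
odd-suc⇒¬odd (suc (suc n)) h = odd-suc⇒¬odd n h

¬odd-suc⇒odd : ∀ n → ¬ (suc n % 2 ≡ 1) → n % 2 ≡ 1
¬odd-suc⇒odd zero          h = contradiction refl h
¬odd-suc⇒odd (suc zero)    _ = refl
¬odd-suc⇒odd (suc (suc n)) h = ¬odd-suc⇒odd n h

data Tally : List ℕ → ℕ → ℕ → Set where
  []  : Tally [] 0 0
  one : ∀ {xs a b} → Tally xs a b → Tally (1 ∷ xs) (suc a) b
  two : ∀ {xs a b} → Tally xs a b → Tally (2 ∷ xs) a (suc b)

tally-replicate : ∀ a b → Tally (1 ^^ a ++ 2 ^^ b) a b
tally-replicate (suc a) b       = one (tally-replicate a b)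
tally-replicate zero    zero    = []
tally-replicate zero    (suc b) = two (tally-replicate zero b)

data Attacker : ℕ → ℕ → ℕ → Set where
  withOne : ∀ {a b} → Attacker 1 (suc a) b
  withTwo : ∀ {a b} → Attacker 2 a (suc b)

-- Hit x c d c′ d′: a hit with x > 0 fingers on a side holding c ones and d twos can leave it
-- with c′ ones and d′ twos (finger count 2).
data Hit : ℕ → ℕ → ℕ → ℕ → ℕ → Set where
  promote : ∀ {c d}   → Hit 1 (suc c) d c (suc d)
  killTwo : ∀ {x c d} → Hit (suc x) c (suc d) c d
  killOne : ∀ {x c d} → Hit (suc (suc x)) (suc c) d c d

attacker-sucˡ : ∀ {x a b} → Attacker x a b → Attacker x (suc a) b
attacker-sucˡ withOne = withOne
attacker-sucˡ withTwo = withTwo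

attacker-sucʳ : ∀ {x a b} → Attacker x a b → Attacker x a (suc b)
attacker-sucʳ withOne = withOne
attacker-sucʳ withTwo = withTwo

attacker-size : ∀ {x a b} → Attacker x a b → 0 < a + b
attacker-size withOne = s≤s z≤n
attacker-size (withTwo {a} {b}) = <-≤-trans (s≤s z≤n) (m≤n+m (suc b) a)

attacker-positive : ∀ {x a b} → Attacker x a b → 0 < x
attacker-positive withOne = s≤s z≤n
attacker-positive withTwo = s≤s z≤n

hit-sucˡ : ∀ {x c d c′ d′} → Hit x c d c′ d′ → Hit x (suc c) d (suc c′) d′
hit-sucˡ promote = promote
hit-sucˡ killTwo = killTwo
hit-sucˡ killOne = killOne

hit-sucʳ : ∀ {x c d c′ d′} → Hit x c d c′ d′ → Hit x c (suc d) c′ (suc d′)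
hit-sucʳ promote = promote
hit-sucʳ killTwo = killTwo
hit-sucʳ killOne = killOne

weight : ℕ → ℕ → ℕ
weight c d = c + c + d

hit-decreases-weight : ∀ {x c d c′ d′} → Hit x c d c′ d′ → weight c′ d′ < weight c d
hit-decreases-weight {c = suc c} {d} promote rewrite +-suc (c + c) d | +-suc c c = ≤-refl
hit-decreases-weight {c = c} {suc d} killTwo = +-monoʳ-< (c + c) (n<1+n d)
hit-decreases-weight {c = suc c} {d} killOne rewrite +-suc c c = n≤1+n _

hit-size : ∀ {x c d c′ d′} → Hit x c d c′ d′ → c + d ≤ suc (c′ + d′)
hit-size {c = suc c} {d} promote = s≤s (+-monoʳ-≤ c (n≤1+n d))
hit-size {c = c} {suc d} killTwo = ≤-reflexive (+-suc c d)
hit-size killOne = ≤-refl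

lookup-attacker : ∀ {xs a b} → Tally xs a b → (i : Fin (length xs)) → Attacker (lookup xs i) a b
lookup-attacker (one t) zero    = withOne
lookup-attacker (two t) zero    = withTwo
lookup-attacker (one t) (suc i) = attacker-sucˡ (lookup-attacker t i)
lookup-attacker (two t) (suc i) = attacker-sucʳ (lookup-attacker t i)

attacker-lookup : ∀ {xs x a b} → Tally xs a b → Attacker x a b → ∃ λ (i : Fin (length xs)) → lookup xs i ≡ x
attacker-lookup (one t) withOne = zero , refl
attacker-lookup (two t) withTwo = zero , refl
attacker-lookup (one t) withTwo with attacker-lookup t withTwo
... | i , e = suc i , e
attacker-lookup (two t) withOne with attacker-lookup t withOne
... | i , e = suc i , e

hit-∷ : ∀ n y ys j x → hit n (y ∷ ys) (suc j) x ≡ y ∷ hit n ys j x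
hit-∷ n y ys j x with n <? lookup ys j + x
... | yes _ = refl
... | no  _ = refl

tally-hit : ∀ {ys c d x} → 0 < x → Tally ys c d → (j : Fin (length ys)) →
            ∃₂ λ c′ d′ → Hit x c d c′ d′ × Tally (hit 2 ys j x) c′ d′
tally-hit {x = 1}             _ (one t) zero = _ , _ , promote , two t
tally-hit {x = suc (suc x)}   _ (one t) zero = _ , _ , killOne , t
tally-hit {x = suc x}         _ (two t) zero = _ , _ , killTwo , t
tally-hit {x = x} p (one {xs} t) (suc j) rewrite hit-∷ 2 1 xs j x with tally-hit p t j
... | c′ , d′ , h , t′ = suc c′ , d′ , hit-sucˡ h , one t′
tally-hit {x = x} p (two {xs} t) (suc j) rewrite hit-∷ 2 2 xs j x with tally-hit p t j
... | c′ , d′ , h , t′ = c′ , suc d′ , hit-sucʳ h , two t′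

hit-tally : ∀ {ys x c d c′ d′} → Hit x c d c′ d′ → Tally ys c d →
            ∃ λ (j : Fin (length ys)) → Tally (hit 2 ys j x) c′ d′
hit-tally promote (one t) = zero , two t
hit-tally killTwo (two t) = zero , t
hit-tally killOne (one t) = zero , t
hit-tally promote (two {xs} t) with hit-tally promote t
... | j , t′ = suc j , subst (λ zs → Tally zs _ _) (sym (hit-∷ 2 2 xs j 1)) (two t′)
hit-tally {x = x} killTwo (one {xs} t) with hit-tally killTwo t
... | j , t′ = suc j , subst (λ zs → Tally zs _ _) (sym (hit-∷ 2 1 xs j x)) (one t′)
hit-tally {x = x} killOne (two {xs} t) with hit-tally killOne t
... | j , t′ = suc j , subst (λ zs → Tally zs _ _) (sym (hit-∷ 2 2 xs j x)) (two t′)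

-- Tallies (a ones, b twos for the player to move; c ones, d twos for the opponent) won by the mover.
data WinsFirst : ℕ → ℕ → ℕ → ℕ → Set where
  ahead   : ∀ {a b c d} → c + d < a + b → 0 < c + d → WinsFirst a b c d
  level   : ∀ {a b c d} → a + b ≡ c + d → 0 < c + d → ¬ (d ≡ 0 × a % 2 ≡ 1) → WinsFirst a b c d
  oddOnes : ∀ {a c d} → a ≡ c + d → c % 2 ≡ 1 → WinsFirst a 0 c (suc d)

data WinsSecond : ℕ → ℕ → ℕ → ℕ → Set where
  noOwnHands      : ∀ {c d} → WinsSecond 0 0 c d
  noOpposingHands : ∀ {a b} → WinsSecond a b 0 0
  aheadBy2        : ∀ {a b c d} → suc (c + d) < a + b → WinsSecond a b c d
  aheadBy1        : ∀ {a b c d} → a + b ≡ suc (c + d) → ¬ (d ≡ 0 × 0 < b × a % 2 ≡ 1) → WinsSecond a b c d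
  levelOddOnes    : ∀ {a c d} → a ≡ c + d → c % 2 ≡ 1 → WinsSecond a 0 c d

data MoveInto (P : ℕ → ℕ → ℕ → ℕ → Set) (a b c d : ℕ) : Set where
  attack : ∀ {x c′ d′} → Attacker x a b → Hit x c d c′ d′ → P a b c′ d′ → MoveInto P a b c d

killTwo-withAny : ∀ {P a b c d} → 0 < a + b → P a b c d → MoveInto P a b c (suc d)
killTwo-withAny {a = suc a}           _ p = attack withOne killTwo p
killTwo-withAny {a = zero} {b = suc b} _ p = attack withTwo killTwo p

ahead-move : ∀ {a b c d} → c + d < a + b → 0 < c + d → MoveInto WinsSecond a b c d
ahead-move {a} {b} {c} {suc d} lt _ =
  killTwo-withAny (<-≤-trans (s≤s z≤n) lt) (aheadBy2 (subst (λ n → suc n ≤ a + b) (+-suc c d) lt))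
ahead-move {b = suc b} {suc c} {zero} lt _ = attack withTwo killOne (aheadBy2 lt)
ahead-move {suc a} {zero} {suc c} {zero} lt _ with m≤n⇒m<n∨m≡n lt
... | inj₁ lt′ = attack withOne promote (aheadBy2 (subst (λ n → suc n < suc a + 0) (sym (+-suc c 0)) lt′))
... | inj₂ eq  = attack withOne promote (aheadBy1 (trans (sym eq) (cong suc (sym (+-suc c 0)))) λ { (() , _) })
ahead-move {zero} {zero} () _
ahead-move {c = zero} {zero} _ ()

level-move : ∀ {a b c d} → a + b ≡ c + d → 0 < c + d → ¬ (d ≡ 0 × a % 2 ≡ 1) →
             MoveInto WinsSecond a b c d
level-move {c = c} {suc (suc d)} e pos _ =
  killTwo-withAny (subst (0 <_) (sym e) pos) (aheadBy1 (trans e (+-suc c (suc d))) λ { (() , _) })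
level-move {b = zero} {c} {suc zero} e pos _ =
  killTwo-withAny (subst (0 <_) (sym e) pos) (aheadBy1 (trans e (+-suc c 0)) λ { (_ , () , _) })
level-move {b = suc b} {zero} {suc zero} _ _ _ = attack withTwo killTwo noOpposingHands
level-move {b = suc b} {suc c} {suc zero} e _ _ = attack withTwo killOne (aheadBy1 e λ { (() , _) })
level-move {b = suc b} {suc c} {zero} e _ even =
  attack withTwo killOne (aheadBy1 e λ { (_ , _ , odd) → even (refl , odd) })
level-move {a} {zero} {suc c} {zero} e _ even
  with trans (sym (+-identityʳ a)) (trans e (cong suc (+-identityʳ c)))
... | refl =
  attack withOne promote (levelOddOnes (sym (+-comm c 1)) (¬odd-suc⇒odd c λ odd → even (refl , odd)))
level-move {c = zero} {zero} _ () _

winsFirst-move : ∀ {a b c d} → WinsFirst a b c d → MoveInto WinsSecond a b c d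
winsFirst-move (ahead lt pos)     = ahead-move lt pos
winsFirst-move (level e pos even) = level-move e pos even
winsFirst-move (oddOnes {c = suc c} refl odd) = attack withOne killTwo (levelOddOnes refl odd)

winsSecond-reply : ∀ {a b c d y a′ b′} →
                   WinsSecond a b c d → Attacker y c d → Hit y a b a′ b′ → WinsFirst a′ b′ c d
winsSecond-reply noOwnHands      _       ()
winsSecond-reply noOpposingHands ()      _
winsSecond-reply (aheadBy2 lt) att h = ahead (≤-pred (≤-trans lt (hit-size h))) (attacker-size att)
winsSecond-reply {b = b} (aheadBy1 {suc a} e _) att promote =
  ahead (≤-reflexive (sym (trans (+-suc a b) e))) (attacker-size att)
winsSecond-reply {a} (aheadBy1 {b = suc b} e cond) att killTwo =
  level (suc-injective (trans (sym (+-suc a b)) e)) (attacker-size att)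
        λ { (d≡0 , odd) → cond (d≡0 , s≤s z≤n , odd) }
winsSecond-reply (aheadBy1 e _) withTwo killOne =
  level (suc-injective e) (attacker-size withTwo) λ { (() , _) }
winsSecond-reply {c = c} (levelOddOnes {suc a} e odd) att promote =
  level (trans (+-comm a 1) e) (attacker-size att)
        λ { (refl , odd′) →
              odd-suc⇒¬odd a (subst (λ n → n % 2 ≡ 1) (trans (sym (+-identityʳ c)) (sym e)) odd) odd′ }
winsSecond-reply {c = c} (levelOddOnes e odd) (withTwo {b = d}) killOne =
  oddOnes (suc-injective (trans e (+-suc c d))) odd

module Game (F S : ℕ → ℕ → ℕ → ℕ → Set)
         (move  : ∀ {a b c d} → F a b c d → MoveInto S a b c d)
         (reply : ∀ {a b c d y a′ b′} → S a b c d → Attacker y c d → Hit y a b a′ b′ → F a′ b′ c d)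
  where

  mutual
    leftWinsFirst-fuel : ∀ k {xs ys a b c d} → weight a b + weight c d < k →
                         Tally xs a b → Tally ys c d → F a b c d → LeftWinsFirst 2 (xs , ys)
    leftWinsFirst-fuel zero    () _ _ _
    leftWinsFirst-fuel (suc k) {xs} {ys} {a} {b} lt txs tys f with move f
    ... | attack att h s with attacker-lookup txs att | hit-tally h tys
    ... | i , refl | j , tys′ =
      lwf _ (lmove xs ys i j)
          (leftWinsSecond-fuel k (<-≤-trans (+-monoʳ-< (weight a b) (hit-decreases-weight h)) (≤-pred lt))
                               txs tys′ s)

    leftWinsSecond-fuel : ∀ k {xs ys a b c d} → weight a b + weight c d < k →
                          Tally xs a b → Tally ys c d → S a b c d → LeftWinsSecond 2 (xs , ys)
    leftWinsSecond-fuel k {xs} {ys} {c = c} {d} lt txs tys s = lws λ { _ (rmove _ _ i j) → respond i j }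
      where
      respond : ∀ i j → LeftWinsFirst 2 (hit 2 xs i (lookup ys j) , ys)
      respond i j with tally-hit (attacker-positive (lookup-attacker tys j)) txs i
      ... | _ , _ , h , txs′ =
        leftWinsFirst-fuel k (<-trans (+-monoˡ-< (weight c d) (hit-decreases-weight h)) lt)
                           txs′ tys (reply s (lookup-attacker tys j) h)

  leftWinsFirst : ∀ a b c d → F a b c d → LeftWinsFirst 2 (pos12 a b c d)
  leftWinsFirst a b c d =
    leftWinsFirst-fuel _ ≤-refl (tally-replicate a b) (tally-replicate c d)

  leftWinsSecond : ∀ a b c d → S a b c d → LeftWinsSecond 2 (pos12 a b c d)
  leftWinsSecond a b c d =
    leftWinsSecond-fuel _ ≤-refl (tally-replicate a b) (tally-replicate c d)

mutual
  swap-winsFirst : ∀ {n xs ys} → LeftWinsFirst n (ys , xs) → RightWinsFirst n (xs , ys)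
  swap-winsFirst (lwf _ (lmove ys xs i j) w) = rwf _ (rmove xs ys j i) (swap-winsSecond w)

  swap-winsSecond : ∀ {n xs ys} → LeftWinsSecond n (ys , xs) → RightWinsSecond n (xs , ys)
  swap-winsSecond (lws w) = rws λ { _ (lmove xs ys i j) → swap-winsFirst (w _ (rmove ys xs j i)) }

open Game WinsFirst WinsSecond winsFirst-move winsSecond-reply

rightWinsFirst : ∀ a b c d → WinsFirst c d a b → RightWinsFirst 2 (pos12 a b c d)
rightWinsFirst a b c d w = swap-winsFirst (leftWinsFirst c d a b w)

rightWinsSecond : ∀ a b c d → WinsSecond c d a b → RightWinsSecond 2 (pos12 a b c d)
rightWinsSecond a b c d w = swap-winsSecond (leftWinsSecond c d a b w)

nonempty⇒0<+ : ∀ {c d} → ¬ (c ≡ 0 × d ≡ 0) → 0 < c + d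
nonempty⇒0<+ {c} nz = n≢0⇒n>0 λ c+d≡0 → nz (m+n≡0⇒m≡0 c c+d≡0 , m+n≡0⇒n≡0 c c+d≡0)

+-suc≡suc+0⇒≡ : ∀ m n k → m + suc n ≡ suc (k + 0) → k ≡ m + n
+-suc≡suc+0⇒≡ m n k e = trans (sym (+-identityʳ k)) (suc-injective (trans (sym e) (+-suc m n)))

leftAhead-𝓝 : ∀ a b c → a + b ≡ suc (c + 0) → 0 < c + 0 → 0 < b → a % 2 ≡ 1 → HasOutcome 2 (pos12 a b c 0) 𝓝
leftAhead-𝓝 a (suc b) c e pos _ odd =
    leftWinsFirst a (suc b) c 0 (ahead (≤-reflexive (sym e)) pos)
  , rightWinsFirst a (suc b) c 0 (oddOnes (+-suc≡suc+0⇒≡ a b c e) odd)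

rightAhead-𝓝 : ∀ a c d → c + d ≡ suc (a + 0) → 0 < a + 0 → 0 < d → c % 2 ≡ 1 → HasOutcome 2 (pos12 a 0 c d) 𝓝
rightAhead-𝓝 a c (suc d) e pos _ odd =
    leftWinsFirst a 0 c (suc d) (oddOnes (+-suc≡suc+0⇒≡ c d a e) odd)
  , rightWinsFirst a 0 c (suc d) (ahead (≤-reflexive (sym e)) pos)

proposition3p5 : (a b c d : ℕ) →
    (a + b ≡ suc (c + d) →
      ((c ≡ 0 × d ≡ 0) → HasOutcome 2 (pos12 a b c d) 𝓟)
      × (¬ (c ≡ 0 × d ≡ 0) → (d ≡ 0 × 0 < b × a % 2 ≡ 1) → HasOutcome 2 (pos12 a b c d) 𝓝)
      × (¬ (c ≡ 0 × d ≡ 0) → ¬ (d ≡ 0 × 0 < b × a % 2 ≡ 1) → HasOutcome 2 (pos12 a b c d) 𝓛))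
    × (c + d ≡ suc (a + b) →
      ((a ≡ 0 × b ≡ 0) → HasOutcome 2 (pos12 a b c d) 𝓟)
      × (¬ (a ≡ 0 × b ≡ 0) → (b ≡ 0 × 0 < d × c % 2 ≡ 1) → HasOutcome 2 (pos12 a b c d) 𝓝)
      × (¬ (a ≡ 0 × b ≡ 0) → ¬ (b ≡ 0 × 0 < d × c % 2 ≡ 1) → HasOutcome 2 (pos12 a b c d) 𝓡))
proposition3p5 a b c d =
    (λ e → (λ { (refl , refl) → leftWinsSecond a b 0 0 noOpposingHands , rightWinsSecond a b 0 0 noOwnHands })
         , (λ { nz (refl , b>0 , odd) → leftAhead-𝓝 a b c e (nonempty⇒0<+ nz) b>0 odd })
         , λ nz cond → leftWinsFirst a b c d (ahead (≤-reflexive (sym e)) (nonempty⇒0<+ nz))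
                     , leftWinsSecond a b c d (aheadBy1 e cond))
  , (λ e → (λ { (refl , refl) → leftWinsSecond 0 0 c d noOwnHands , rightWinsSecond 0 0 c d noOpposingHands })
         , (λ { nz (refl , d>0 , odd) → rightAhead-𝓝 a c d e (nonempty⇒0<+ nz) d>0 odd })
         , λ nz cond → rightWinsFirst a b c d (ahead (≤-reflexive (sym e)) (nonempty⇒0<+ nz))
                     , rightWinsSecond a b c d (aheadBy1 e cond))
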